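{- Let $m+2\le n$. A graph-type $\mathbb{T}=(\Delta,\iota,\Theta)$ of order $(m,n)$ is $(m,n)$-irreducible if and only if $\operatorname{Cl}(\mathbb{T})$ is $(m+1)$-connected.
   Context: Graphs are finite simple graphs; embeddings are injective maps preserving edges and non-edges. A graph-type is a triple $\mathbb{T}=(\Delta,\iota,\Theta)$ of graphs with an embedding $\iota:\Delta\hookrightarrow\Theta$; order $(|V(\Delta)|,|V(\Theta)|)$. Isomorphism of graph-types: graph isomorphisms $f$ of bases and $g$ of the big graphs with $g\circ\iota_1=\iota_2\circ f$. Free sum: for types $\mathbb{T}_1=(\Delta_1,\iota_1,\Theta_1)$, $\mathbb{T}_2=(\Delta_2,\iota_2,\Theta_2)$ and an embedding $e:\Delta_2\hookrightarrow\Theta_1$, let $\Lambda$ be obtained from the disjoint union of $\Theta_1,\Theta_2$ by identifying $e(v)$ with $\iota_2(v)$ for $v\in V(\Delta_2)$ (the pushout), with induced embedding $\lambda_1:\Theta_1\hookrightarrow\Lambda$; then $\mathbb{T}_1\oplus_e\mathbb{T}_2=(\Delta_1,\lambda_1\circ\iota_1,\Lambda)$. $\mathbb{T}$ is $(m,n)$-irreducible if whenever $\mathbb{T}\cong\mathbb{T}_1\oplus_e\mathbb{T}_2$ with $\mathbb{T}_2$ of order $(k,l)$, $k\le m$, $l\le n$, then $\mathbb{T}\cong\mathbb{T}_1$ or $\mathbb{T}\cong\mathbb{T}_2$. $\operatorname{Cl}(\mathbb{T})$ is the graph with vertex set $V(\Theta)$ whose edges are the edges of $\Theta$ together with all pairs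 of distinct vertices in the image of $\iota$. A graph is $k$-decomposable if there is a $k$-element set of vertices whose deletion leaves a disconnected graph; it is $(k+1)$-connected if it is not $l$-decomposable for any $l\in\{0,\dots,k\}$. -}

module Defs where

open import Data.Nat using (ℕ; _≤_; _<_; _+_; suc)
open import Data.Fin using (Fin)
open import Data.Product using (Σ; ∃; ∃-syntax; _×_; _,_; proj₁)
open import Data.Sum using (_⊎_; inj₁; inj₂)
open import Relation.Nullary using (¬_; Dec)
open import Relation.Binary.PropositionalEquality using (_≡_; _≢_; sym; refl)
open import Function.Bundles using (_↔_; _⇔_)

-- Simple graphs (vertex set an arbitrary type; finiteness is a separate
-- predicate, see IsFinite).

record Graph : Set₁ where
  field
    V      : Set
    E      : V → V → Set
    E-sym  : ∀ {x y} → E x y → E y x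
    E-irr  : ∀ {x} → ¬ E x x
open Graph public

IsFinite : Graph → ℕ → Set
IsFinite G n = (V G ↔ Fin n) × (∀ x y → Dec (E G x y))

record Embedding (G H : Graph) : Set where
  field
    map    : V G → V H
    inj    : ∀ {x y} → map x ≡ map y → x ≡ y
    pres   : ∀ {x y} → E G x y → E H (map x) (map y)
    refl-E : ∀ {x y} → E H (map x) (map y) → E G x y
open Embedding public

_∘ᵉ_ : ∀ {G H K} → Embedding H K → Embedding G H → Embedding G K
g ∘ᵉ f = record
  { map    = λ x → map g (map f x)
  ; inj    = λ p → inj f (inj g p)
  ; pres   = λ e → pres g (pres f e)
  ; refl-E = λ e → refl-E f (refl-E g e)
  }

GraphIso : Graph → Graph → Set
GraphIso G H = Σ (Embedding G H) λ f → ∀ y → ∃[ x ] map f x ≡ y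

record GraphType : Set₁ where
  constructor gtype
  field
    Δ : Graph
    Θ : Graph
    ι : Embedding Δ Θ
open GraphType public

HasOrder : GraphType → ℕ → ℕ → Set
HasOrder T m n = IsFinite (Δ T) m × IsFinite (Θ T) n

TypeIso : GraphType → GraphType → Set
TypeIso T₁ T₂ =
  Σ (GraphIso (Δ T₁) (Δ T₂)) λ f →
  Σ (GraphIso (Θ T₁) (Θ T₂)) λ g →
  ∀ v → map (proj₁ g) (map (ι T₁) v)
        ≡ map (ι T₂) (map (proj₁ f) v)

-- Free sum.  Λ with κ₁ : Θ₁ ↪ Λ, κ₂ : Θ₂ ↪ Λ is the pushout of
-- Θ₁ ←e− Δ₂ −ι₂→ Θ₂ obtained from the disjoint union of Θ₁, Θ₂ by
-- identifying e(v) with ι₂(v): this is described by the following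
-- (concrete, up-to-isomorphism) characterisation of that identification.

record IsPushout {Δ₂ Θ₁ Θ₂ Λ : Graph}
                 (e : Embedding Δ₂ Θ₁) (ι₂ : Embedding Δ₂ Θ₂)
                 (κ₁ : Embedding Θ₁ Λ) (κ₂ : Embedding Θ₂ Λ) : Set where
  field
    commute : ∀ v → map κ₁ (map e v) ≡ map κ₂ (map ι₂ v)
    cover   : ∀ z → (∃[ x ] map κ₁ x ≡ z) ⊎ (∃[ w ] map κ₂ w ≡ z)
    glue    : ∀ x w → map κ₁ x ≡ map κ₂ w →
              ∃[ v ] (map e v ≡ x × map ι₂ v ≡ w)
    edges   : ∀ a b → E Λ a b →
              (∃[ x ] ∃[ y ] (map κ₁ x ≡ a × map κ₁ y ≡ b × E Θ₁ x y))
              ⊎ (∃[ x ] ∃[ y ] (map κ₂ x ≡ a × map κ₂ y ≡ b × E Θ₂ x y))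

IsoToFreeSum : (T T₁ T₂ : GraphType) → Embedding (Δ T₂) (Θ T₁) → Set₁
IsoToFreeSum T T₁ T₂ e =
  Σ Graph λ Λ →
  Σ (Embedding (Θ T₁) Λ) λ κ₁ →
  Σ (Embedding (Θ T₂) Λ) λ κ₂ →
  IsPushout e (ι T₂) κ₁ κ₂ × TypeIso T (gtype (Δ T₁) Λ (κ₁ ∘ᵉ ι T₁))

Irreducible : ℕ → ℕ → GraphType → Set₁
Irreducible m n T =
  ∀ (T₁ T₂ : GraphType) (e : Embedding (Δ T₂) (Θ T₁)) →
  (∃[ k₁ ] ∃[ l₁ ] HasOrder T₁ k₁ l₁) →
  ∀ k l → HasOrder T₂ k l → k ≤ m → l ≤ n →
  IsoToFreeSum T T₁ T₂ e →
  TypeIso T T₁ ⊎ TypeIso T T₂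

ClE : (T : GraphType) → V (Θ T) → V (Θ T) → Set
ClE T x y = E (Θ T) x y
            ⊎ (x ≢ y × ∃[ a ] ∃[ b ] (map (ι T) a ≡ x × map (ι T) b ≡ y))

ClE-sym : (T : GraphType) → ∀ {x y} → ClE T x y → ClE T y x
ClE-sym T (inj₁ p) = inj₁ (E-sym (Θ T) p)
ClE-sym T (inj₂ (ne , a , b , pa , pb)) = inj₂ ((λ q → ne (sym q)) , b , a , pb , pa)

ClE-irr : (T : GraphType) → ∀ {x} → ¬ ClE T x x
ClE-irr T (inj₁ p) = E-irr (Θ T) p
ClE-irr T (inj₂ (ne , _)) = ne refl

Cl : GraphType → Graph
Cl T = record { V = V (Θ T) ; E = ClE T ; E-sym = ClE-sym T ; E-irr = ClE-irr T }

data Reach (G : Graph) (P : V G → Set) : V G → V G → Set where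
  here : ∀ {x} → P x → Reach G P x x
  step : ∀ {x y z} → P x → E G x y → Reach G P y z → Reach G P x z

Decomposable : Graph → ℕ → Set
Decomposable G k =
  Σ (Fin k → V G) λ s →
    (∀ {i j} → s i ≡ s j → i ≡ j) ×
    (∃[ x ] ∃[ y ] (NotIn s x × NotIn s y × ¬ Reach G (NotIn s) x y))
  where
  NotIn : (Fin k → V G) → V G → Set
  NotIn s x = ∀ i → s i ≢ x

IsConnected : Graph → ℕ → Set
IsConnected G c = ∀ l → l < c → ¬ Decomposable G l

module Submission where

-- A free sum T₁ ⊕ₑ T₂ is a separation of Θ: the copy of Δ₂ separates the vertices of Θ₁
-- outside e(Δ₂) from those of Θ₂ outside ι₂(Δ₂), and in Cl(T) it still does so, because the
-- clique ι(Δ) lies in Θ₁. So if Cl(T) is (m+1)-connected one of the two sets is empty, and the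
-- corresponding summand is isomorphic to T (for T₂ because an injection Δ ↪ Δ₂ with |Δ₂| ≤ |Δ|
-- is onto).
-- Conversely, let s (|s| ≤ m) separate x from y in Cl(T) and let R be the component of x in
-- Cl(T) − s. As ι(Δ) − s is a clique it lies entirely in R or entirely outside it; splitting Θ
-- into s ∪ (the side containing ι(Δ)) and s ∪ (the other side) writes T as a free sum whose two
-- big graphs are proper induced subgraphs of Θ, so neither summand is isomorphic to T.
-- R is decidable only under double negation, which suffices since the goal is ⊥.

open import Defs
open import Data.Bool using (Bool; true; false; T; not; _∨_)
open import Data.Bool.Properties using (T-irrelevant)
open import Data.Empty using (⊥; ⊥-elim)
open import Data.Fin using (Fin; zero; suc; punchOut; _≟_)
open import Data.Fin.Properties using (any?; injective⇒≤; punchOut-injective)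
open import Data.Nat using (ℕ; zero; suc; _≤_; _<_; _+_; z≤n; s≤s)
open import Data.Nat.Properties
  using (≤-refl; ≤-reflexive; ≤-trans; ≤-antisym; +-comm; m≤n⇒m≤1+n; m<1+n⇒m≤n; 1+n≰n)
open import Data.Product using (Σ; ∃; ∃-syntax; _×_; _,_; proj₁; proj₂)
open import Data.Product.Function.Dependent.Propositional using () renaming (cong to Σ-cong)
open import Data.Sum using (_⊎_; inj₁; inj₂)
open import Data.Unit using (tt)
open import Function using (_∘_)
open import Function.Bundles using (_↔_; _⇔_; Inverse; Injection; mk↔ₛ′; mk⇔)
open import Function.Definitions using (Injective)
open import Function.Properties.Inverse using (↔-refl; ↔-sym; ↔-trans; ↔⇒↣)
open import Relation.Binary.Definitions using (DecidableEquality)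
open import Relation.Binary.PropositionalEquality
open ≡-Reasoning
open import Relation.Nullary using (¬_; Dec; yes; no; contradiction)
open import Relation.Nullary.Decidable
  using (map′; via-injection; ¬?; decidable-stable; ¬¬-excluded-middle; isYes; isNo; isYes≗does; does-⇔;
         fromWitness; toWitness; fromWitnessFalse; toWitnessFalse)
open import Relation.Nullary.Negation using (DoubleNegation)
open import Relation.Unary using (Decidable)

isYes-⇔ : {A B : Set} → A ⇔ B → (a? : Dec A) (b? : Dec B) → isYes a? ≡ isYes b?
isYes-⇔ A⇔B a? b? = trans (isYes≗does a?) (trans (does-⇔ A⇔B a? b?) (sym (isYes≗does b?)))

≤⇒<+1 : ∀ {k m} → k ≤ m → k < m + 1
≤⇒<+1 {m = m} k≤m = ≤-trans (s≤s k≤m) (≤-reflexive (+-comm 1 m))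

<+1⇒≤ : ∀ {k m} → k < m + 1 → k ≤ m
<+1⇒≤ {m = m} k<m+1 = m<1+n⇒m≤n (≤-trans k<m+1 (≤-reflexive (+-comm m 1)))

T-∨-intro : ∀ a b → (¬ T a → T b) → T (a ∨ b)
T-∨-intro true  _ _   = tt
T-∨-intro false _ a⇒b = a⇒b λ ()

T-∨-elim : ∀ a b → T (a ∨ b) → ¬ T a → T b
T-∨-elim true  _ _ ¬a = contradiction tt ¬a
T-∨-elim false _ b _  = b

T-not⇒¬T : ∀ b → T (not b) → ¬ T b
T-not⇒¬T true  ()
T-not⇒¬T false _ ()

T-∨-or-∨-not : ∀ a b → T (a ∨ b) ⊎ T (a ∨ not b)
T-∨-or-∨-not true  _     = inj₁ tt
T-∨-or-∨-not false true  = inj₁ tt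
T-∨-or-∨-not false false = inj₂ tt

T-∨-and-∨-not : ∀ a b → T (a ∨ b) → T (a ∨ not b) → T a
T-∨-and-∨-not true  _     _ _ = tt
T-∨-and-∨-not false true  _ ()
T-∨-and-∨-not false false ()

T-∨-same-side : ∀ a b c d → (¬ T a → ¬ T c → b ≡ d) →
                         (T (a ∨ b) × T (c ∨ d)) ⊎ (T (a ∨ not b) × T (c ∨ not d))
T-∨-same-side true  _     true  _     _ = inj₁ (tt , tt)
T-∨-same-side true  _     false true  _ = inj₁ (tt , tt)
T-∨-same-side true  _     false false _ = inj₂ (tt , tt)
T-∨-same-side false true  true  _     _ = inj₁ (tt , tt)
T-∨-same-side false false true  _     _ = inj₂ (tt , tt)
T-∨-same-side false true  false true  _ = inj₁ (tt , tt)
T-∨-same-side false false false false _ = inj₂ (tt , tt)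
T-∨-same-side false true  false false b≡d = contradiction (b≡d (λ ()) (λ ())) λ ()
T-∨-same-side false false false true  b≡d = contradiction (b≡d (λ ()) (λ ())) λ ()

↔-injective : {A B : Set} (φ : A ↔ B) → Injective _≡_ _≡_ (Inverse.to φ)
↔-injective φ = Injection.injective (↔⇒↣ φ)

Onto : {A B : Set} → (A → B) → Set
Onto f = ∀ y → ∃[ x ] f x ≡ y

module _ {A : Set} {a : ℕ} (φ : A ↔ Fin a) where
  open Inverse φ

  finite-≟ : DecidableEquality A
  finite-≟ = via-injection (↔⇒↣ φ) _≟_

  finite-∃? : {P : A → Set} → Decidable P → Dec (∃ P)
  finite-∃? {P} P? = map′ (λ (i , p) → from i , p)
                          (λ (x , p) → to x , subst P (sym (strictlyInverseʳ x)) p)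
                          (any? (P? ∘ from))

  finite-¬¬-decidable : (P : A → Set) → DoubleNegation (Decidable P)
  finite-¬¬-decidable P ¬P? = Fin-¬¬-decidable (P ∘ from)
    λ P∘from? → ¬P? λ x → subst (Dec ∘ P) (strictlyInverseʳ x) (P∘from? (to x))
    where
    Fin-¬¬-decidable : ∀ {n} (Q : Fin n → Set) → DoubleNegation (Decidable Q)
    Fin-¬¬-decidable {zero}  Q ¬Q? = ¬Q? λ ()
    Fin-¬¬-decidable {suc n} Q ¬Q? = ¬¬-excluded-middle λ Q0? →
      Fin-¬¬-decidable (Q ∘ suc) λ Q∘suc? → ¬Q? λ { zero → Q0? ; (suc i) → Q∘suc? i }

Fin-injective⇒onto : ∀ {n} (f : Fin n → Fin n) → Injective _≡_ _≡_ f → Onto f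
Fin-injective⇒onto {suc n} f f-inj y with any? (λ i → f i ≟ y)
... | yes hit = hit
... | no miss = contradiction (injective⇒≤ punchOut∘f-injective) 1+n≰n
  where
  f≢y : ∀ i → y ≢ f i
  f≢y i y≡fi = miss (i , sym y≡fi)
  punchOut∘f-injective : Injective _≡_ _≡_ (λ i → punchOut (f≢y i))
  punchOut∘f-injective eq = f-inj (punchOut-injective (f≢y _) (f≢y _) eq)

finite-injective⇒onto : {A B : Set} {a b : ℕ} → A ↔ Fin a → B ↔ Fin b → b ≤ a →
                        (f : A → B) → Injective _≡_ _≡_ f → Onto f
finite-injective⇒onto {a = a} φ ψ b≤a f f-inj y = onto (≤-antisym (injective⇒≤ f′-injective) b≤a)
  where
  open Inverse
  f′ : Fin a → Fin _
  f′ = to ψ ∘ f ∘ from φ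
  f′-injective : Injective _≡_ _≡_ f′
  f′-injective = ↔-injective (↔-sym φ) ∘ f-inj ∘ ↔-injective ψ
  onto : a ≡ _ → ∃[ x ] f x ≡ y
  onto refl with Fin-injective⇒onto f′ f′-injective (to ψ y)
  ... | i , f′i≡y = from φ i , ↔-injective ψ f′i≡y

onto-or-missed : {A B : Set} {a b : ℕ} → A ↔ Fin a → B ↔ Fin b → (f : A → B) →
                 Onto f ⊎ ∃[ y ] ¬ (∃[ x ] f x ≡ y)
onto-or-missed φ ψ f with finite-∃? ψ (λ y → ¬? (finite-∃? φ (λ x → finite-≟ ψ (f x) y)))
... | yes missed = inj₂ missed
... | no ¬missed = inj₁ λ y → decidable-stable (finite-∃? φ (λ x → finite-≟ ψ (f x) y))
                                                 (λ unhit → ¬missed (y , unhit))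

Fin-count : ∀ {n} (p : Fin n → Bool) → ∃[ k ] k ≤ n × (Σ (Fin n) (T ∘ p) ↔ Fin k)
Fin-count {zero} p = zero , z≤n , mk↔ₛ′ (λ ()) (λ ()) (λ ()) (λ ())
Fin-count {suc n} p with Fin-count (p ∘ suc) | p zero in p0≡
... | k , k≤n , φ | true = suc k , s≤s k≤n , mk↔ₛ′ to′ from′ to∘from from∘to
  where
  open Inverse φ
  to′ : Σ (Fin (suc n)) (T ∘ p) → Fin (suc k)
  to′ (zero , _) = zero
  to′ (suc i , t) = suc (to (i , t))
  from′ : Fin (suc k) → Σ (Fin (suc n)) (T ∘ p)
  from′ zero = zero , subst T (sym p0≡) tt
  from′ (suc j) = let (i , t) = from j in suc i , t
  to∘from : ∀ j → to′ (from′ j) ≡ j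
  to∘from zero = refl
  to∘from (suc j) = cong suc (strictlyInverseˡ j)
  from∘to : ∀ x → from′ (to′ x) ≡ x
  from∘to (zero , t) = cong (zero ,_) (T-irrelevant _ t)
  from∘to (suc i , t) = cong (λ (i′ , t′) → suc i′ , t′) (strictlyInverseʳ (i , t))
... | k , k≤n , φ | false = k , m≤n⇒m≤1+n k≤n , mk↔ₛ′ to′ from′ strictlyInverseˡ from∘to
  where
  open Inverse φ
  to′ : Σ (Fin (suc n)) (T ∘ p) → Fin k
  to′ (zero , t) = ⊥-elim (subst T p0≡ t)
  to′ (suc i , t) = to (i , t)
  from′ : Fin k → Σ (Fin (suc n)) (T ∘ p)
  from′ j = let (i , t) = from j in suc i , t
  from∘to : ∀ x → from′ (to′ x) ≡ x
  from∘to (zero , t) = ⊥-elim (subst T p0≡ t)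
  from∘to (suc i , t) = cong (λ (i′ , t′) → suc i′ , t′) (strictlyInverseʳ (i , t))

finite-count : {A : Set} {a : ℕ} → A ↔ Fin a → (p : A → Bool) →
               ∃[ k ] k ≤ a × (Σ A (T ∘ p) ↔ Fin k)
finite-count φ p with Fin-count (p ∘ Inverse.from φ)
... | k , k≤a , ψ = k , k≤a , ↔-trans (Σ-cong φ fibre) ψ
  where
  fibre : ∀ {x} → T (p x) ↔ T (p (Inverse.from φ (Inverse.to φ x)))
  fibre {x} = subst (λ y → T (p x) ↔ T (p y)) (sym (Inverse.strictlyInverseʳ φ x)) ↔-refl

module _ {G H : Graph} (φ : GraphIso G H) where
  private
    f = proj₁ φ

  iso⁻¹ : V H → V G
  iso⁻¹ y = proj₁ (proj₂ φ y)

  iso-inverseˡ : ∀ y → map f (iso⁻¹ y) ≡ y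
  iso-inverseˡ y = proj₂ (proj₂ φ y)

  iso-inverseʳ : ∀ x → iso⁻¹ (map f x) ≡ x
  iso-inverseʳ x = inj f (iso-inverseˡ (map f x))

  graphIso-sym : GraphIso H G
  graphIso-sym = record
    { map    = iso⁻¹
    ; inj    = λ {y} {y′} eq → trans (sym (iso-inverseˡ y)) (trans (cong (map f) eq) (iso-inverseˡ y′))
    ; pres   = λ {y} {y′} e → refl-E f (subst₂ (E H) (sym (iso-inverseˡ y)) (sym (iso-inverseˡ y′)) e)
    ; refl-E = λ {y} {y′} e → subst₂ (E H) (iso-inverseˡ y) (iso-inverseˡ y′) (pres f e)
    } , λ x → map f x , iso-inverseʳ x

graphIso-refl : {G : Graph} → GraphIso G G
graphIso-refl =
  record { map = λ x → x ; inj = λ eq → eq ; pres = λ e → e ; refl-E = λ e → e } , λ y → y , refl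

graphIso-trans : {G H K : Graph} → GraphIso G H → GraphIso H K → GraphIso G K
graphIso-trans (f , f-onto) (g , g-onto) = g ∘ᵉ f , λ z →
  let (y , gy≡z) = g-onto z ; (x , fx≡y) = f-onto y in x , trans (cong (map g) fx≡y) gy≡z

NotIn : {A B : Set} → (A → B) → B → Set
NotIn s z = ∀ i → s i ≢ z

module _ {G : Graph} {P : V G → Set} where

  Reach-snoc : ∀ {x y z} → Reach G P x y → P z → E G y z → Reach G P x z
  Reach-snoc (here Px)      Pz eyz = step Px eyz (here Pz)
  Reach-snoc (step Px e r) Pz eyz = step Px e (Reach-snoc r Pz eyz)

  Reach-invariant : (Q : V G → Set) → (∀ {a b} → P a → E G a b → Q a → Q b) →
                    ∀ {x y} → Reach G P x y → Q x → Q y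
  Reach-invariant Q Q-step (here _)       Qx = Qx
  Reach-invariant Q Q-step (step Px e r) Qx = Reach-invariant Q Q-step r (Q-step Px e Qx)

  Reach-map : {H : Graph} {Q : V H → Set} (f : Embedding G H) → (∀ {z} → P z → Q (map f z)) →
              ∀ {x y} → Reach G P x y → Reach H Q (map f x) (map f y)
  Reach-map f P⇒Q (here Px)      = here (P⇒Q Px)
  Reach-map f P⇒Q (step Px e r) = step (P⇒Q Px) (pres f e) (Reach-map f P⇒Q r)

decomposable-reflect : ∀ {G H k} → GraphIso G H → Decomposable H k → Decomposable G k
decomposable-reflect {H = H} φ (s , s-inj , x , y , x∉s , y∉s , x↛y) =
  iso⁻¹ φ ∘ s , s-inj ∘ inj (proj₁ (graphIso-sym φ)) ,
  iso⁻¹ φ x , iso⁻¹ φ y , pull x∉s , pull y∉s ,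
  λ r → x↛y (subst₂ (Reach H (NotIn s)) (iso-inverseˡ φ x) (iso-inverseˡ φ y)
                     (Reach-map (proj₁ φ) push r))
  where
  pull : ∀ {z} → NotIn s z → NotIn (iso⁻¹ φ ∘ s) (iso⁻¹ φ z)
  pull z∉s i eq = z∉s i (inj (proj₁ (graphIso-sym φ)) eq)
  push : ∀ {z} → NotIn (iso⁻¹ φ ∘ s) z → NotIn s (map (proj₁ φ) z)
  push z∉s i eq = z∉s i (trans (cong (iso⁻¹ φ) eq) (iso-inverseʳ φ _))

isConnected-transport : ∀ {G H c} → GraphIso G H → IsConnected G c → IsConnected H c
isConnected-transport φ G-conn l l<c = G-conn l l<c ∘ decomposable-reflect φ

Cl-iso : {T₁ T₂ : GraphType} → TypeIso T₁ T₂ → GraphIso (Cl T₁) (Cl T₂)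
Cl-iso {T₁} {T₂} (f , (g , g-onto) , square) = record
  { map = map g ; inj = inj g ; pres = Cl-pres ; refl-E = Cl-reflect } , g-onto
  where
  Cl-pres : ∀ {a b} → ClE T₁ a b → ClE T₂ (map g a) (map g b)
  Cl-pres (inj₁ e) = inj₁ (pres g e)
  Cl-pres (inj₂ (a≢b , u , v , ιu≡a , ιv≡b)) =
    inj₂ (a≢b ∘ inj g , map (proj₁ f) u , map (proj₁ f) v ,
          trans (sym (square u)) (cong (map g) ιu≡a) , trans (sym (square v)) (cong (map g) ιv≡b))
  reflect-ι : ∀ {a} u → map (ι T₂) u ≡ map g a → map (ι T₁) (iso⁻¹ f u) ≡ a
  reflect-ι u ι₂u≡ga = inj g (trans (square _) (trans (cong (map (ι T₂)) (iso-inverseˡ f u)) ι₂u≡ga))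
  Cl-reflect : ∀ {a b} → ClE T₂ (map g a) (map g b) → ClE T₁ a b
  Cl-reflect (inj₁ e) = inj₁ (refl-E g e)
  Cl-reflect (inj₂ (ga≢gb , u , v , ιu≡ga , ιv≡gb)) =
    inj₂ (ga≢gb ∘ cong (map g) , iso⁻¹ f u , iso⁻¹ f v , reflect-ι u ιu≡ga , reflect-ι v ιv≡gb)


module FreeSum (T₁ T₂ : GraphType) {Λ : Graph} {e : Embedding (Δ T₂) (Θ T₁)}
               {κ₁ : Embedding (Θ T₁) Λ} {κ₂ : Embedding (Θ T₂) Λ}
               (po : IsPushout e (ι T₂) κ₁ κ₂) where
  open IsPushout po

  Sum : GraphType
  Sum = gtype (Δ T₁) Λ (κ₁ ∘ᵉ ι T₁)

  κ₁-onto : Onto (map (ι T₂)) → Onto (map κ₁)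
  κ₁-onto ι₂-onto z with cover z
  ... | inj₁ hit = hit
  ... | inj₂ (w , κ₂w≡z) =
    let (v , ι₂v≡w) = ι₂-onto w in map e v , trans (commute v) (trans (cong (map κ₂) ι₂v≡w) κ₂w≡z)

  κ₂-onto : Onto (map e) → Onto (map κ₂)
  κ₂-onto e-onto z with cover z
  ... | inj₂ hit = hit
  ... | inj₁ (x , κ₁x≡z) =
    let (v , ev≡x) = e-onto x
    in map (ι T₂) v , trans (sym (commute v)) (trans (cong (map κ₁) ev≡x) κ₁x≡z)

  separator-decomposable : ∀ {k} → V (Δ T₂) ↔ Fin k → ∀ x w →
                           ¬ (∃[ v ] map e v ≡ x) → ¬ (∃[ v ] map (ι T₂) v ≡ w) →
                           Decomposable (Cl Sum) k
  separator-decomposable φ x w x∉e w∉ι₂ =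
    s , s-injective , map κ₁ x , map κ₂ w , κ₁x∉s , κ₂w∉s , κ₁x↛κ₂w
    where
    open Inverse φ
    s : Fin _ → V Λ
    s = map κ₁ ∘ map e ∘ from
    s-injective : ∀ {i j} → s i ≡ s j → i ≡ j
    s-injective = ↔-injective (↔-sym φ) ∘ inj e ∘ inj κ₁
    InΘ₁ : V Λ → Set
    InΘ₁ z = ∃[ x′ ] map κ₁ x′ ≡ z
    -- An edge of Λ at a ∉ s that is not an edge of Θ₁ comes from Θ₂, and glue would put a in s.
    InΘ₁-step : ∀ {a b} → NotIn s a → ClE Sum a b → InΘ₁ a → InΘ₁ b
    InΘ₁-step _ (inj₂ (_ , _ , u , _ , ιu≡b)) _ = map (ι T₁) u , ιu≡b
    InΘ₁-step a∉s (inj₁ eab) (x′ , κ₁x′≡a) with edges _ _ eab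
    ... | inj₁ (_ , y , _ , κ₁y≡b , _) = y , κ₁y≡b
    ... | inj₂ (x₂ , _ , κ₂x₂≡a , _) with glue x′ x₂ (trans κ₁x′≡a (sym κ₂x₂≡a))
    ... | v , ev≡x′ , _ = ⊥-elim (a∉s (to v) (begin
      map κ₁ (map e (from (to v))) ≡⟨ cong (map κ₁ ∘ map e) (strictlyInverseʳ v) ⟩
      map κ₁ (map e v)             ≡⟨ cong (map κ₁) ev≡x′ ⟩
      map κ₁ x′                    ≡⟨ κ₁x′≡a ⟩
      _                            ∎))
    κ₁x∉s : NotIn s (map κ₁ x)
    κ₁x∉s i eq = x∉e (from i , inj κ₁ eq)
    κ₂w∉s : NotIn s (map κ₂ w)
    κ₂w∉s i eq = let (v , _ , ι₂v≡w) = glue _ _ eq in w∉ι₂ (v , ι₂v≡w)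
    κ₁x↛κ₂w : ¬ Reach (Cl Sum) (NotIn s) (map κ₁ x) (map κ₂ w)
    κ₁x↛κ₂w r with Reach-invariant InΘ₁ InΘ₁-step r (x , refl)
    ... | x′ , κ₁x′≡κ₂w = let (v , _ , ι₂v≡w) = glue x′ w κ₁x′≡κ₂w in w∉ι₂ (v , ι₂v≡w)

  typeIso-summand₁ : ∀ {T} → TypeIso T Sum → Onto (map (ι T₂)) → TypeIso T T₁
  typeIso-summand₁ {T} (f , g , square) ι₂-onto =
    f , graphIso-trans g (graphIso-sym κ₁-iso) , λ v → begin
      iso⁻¹ κ₁-iso (map (proj₁ g) (map (ι T) v))           ≡⟨ cong (iso⁻¹ κ₁-iso) (square v) ⟩
      iso⁻¹ κ₁-iso (map κ₁ (map (ι T₁) (map (proj₁ f) v))) ≡⟨ iso-inverseʳ κ₁-iso _ ⟩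
      map (ι T₁) (map (proj₁ f) v)                         ∎
    where
    κ₁-iso : GraphIso (Θ T₁) Λ
    κ₁-iso = κ₁ , κ₁-onto ι₂-onto

  typeIso-summand₂ : ∀ {T m k} → V (Δ T) ↔ Fin m → V (Δ T₂) ↔ Fin k → k ≤ m →
                     TypeIso T Sum → Onto (map e) → TypeIso T T₂
  typeIso-summand₂ {T} φ φ₂ k≤m (f , g , square) e-onto =
    F-iso , graphIso-trans g (graphIso-sym κ₂-iso) , λ v → begin
      iso⁻¹ κ₂-iso (map (proj₁ g) (map (ι T) v))           ≡⟨ cong (iso⁻¹ κ₂-iso) (square v) ⟩
      iso⁻¹ κ₂-iso (map κ₁ (map (ι T₁) (map (proj₁ f) v)))
        ≡⟨ cong (iso⁻¹ κ₂-iso ∘ map κ₁) (sym (iso-inverseˡ e-iso _)) ⟩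
      iso⁻¹ κ₂-iso (map κ₁ (map e (map F v)))              ≡⟨ cong (iso⁻¹ κ₂-iso) (commute _) ⟩
      iso⁻¹ κ₂-iso (map κ₂ (map (ι T₂) (map F v)))         ≡⟨ iso-inverseʳ κ₂-iso _ ⟩
      map (ι T₂) (map F v)                                 ∎
    where
    e-iso : GraphIso (Δ T₂) (Θ T₁)
    e-iso = e , e-onto
    κ₂-iso : GraphIso (Θ T₂) Λ
    κ₂-iso = κ₂ , κ₂-onto e-onto
    F : Embedding (Δ T) (Δ T₂)
    F = proj₁ (graphIso-sym e-iso) ∘ᵉ (ι T₁ ∘ᵉ proj₁ f)
    F-iso : GraphIso (Δ T) (Δ T₂)
    F-iso = F , finite-injective⇒onto φ φ₂ k≤m (map F) (inj F)

Induced : (G : Graph) {A : Set} → (A → V G) → Graph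
Induced G {A} f = record { V = A ; E = λ a b → E G (f a) (f b) ; E-sym = E-sym G ; E-irr = E-irr G }

induced-embedding : (G : Graph) {A : Set} (f : A → V G) → Injective _≡_ _≡_ f → Embedding (Induced G f) G
induced-embedding G f f-inj = record { map = f ; inj = f-inj ; pres = λ e → e ; refl-E = λ e → e }

Sub : (G : Graph) → (V G → Bool) → Graph
Sub G p = Induced G {Σ (V G) (T ∘ p)} proj₁

proj₁-injective : {A : Set} {p : A → Bool} → Injective _≡_ _≡_ (proj₁ {B = T ∘ p})
proj₁-injective {x = a , t} {.a , t′} refl = cong (a ,_) (T-irrelevant t t′)

sub-inclusion : (G : Graph) (p : V G → Bool) → Embedding (Sub G p) G
sub-inclusion G p = induced-embedding G proj₁ proj₁-injective

corestrict : {H G : Graph} {p : V G → Bool} (f : Embedding H G) → (∀ x → T (p (map f x))) →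
             Embedding H (Sub G p)
corestrict f f∈p = record
  { map = λ x → map f x , f∈p x ; inj = inj f ∘ cong proj₁ ; pres = pres f ; refl-E = refl-E f }

sub-finite : ∀ {G n} → IsFinite G n → (p : V G → Bool) → ∃[ k ] k ≤ n × IsFinite (Sub G p) k
sub-finite (φ , E?) p =
  let (k , k≤n , ψ) = finite-count φ p in k , k≤n , ψ , λ a b → E? (proj₁ a) (proj₁ b)

sub-not-iso : ∀ {G n} → V G ↔ Fin n → (p : V G → Bool) → ∀ w → ¬ T (p w) → ¬ GraphIso G (Sub G p)
sub-not-iso φ p w w∉p (g , _) =
  let (x , gx≡w) = finite-injective⇒onto φ φ ≤-refl (proj₁ ∘ map g) (inj g ∘ proj₁-injective) w
  in w∉p (subst (T ∘ p) gx≡w (proj₂ (map g x)))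

module _ (G : Graph) (p₁ p₂ : V G → Bool) {D : Graph} (s : Embedding D G)
         (s∈p₁ : ∀ v → T (p₁ (map s v))) (s∈p₂ : ∀ v → T (p₂ (map s v)))
         (p₁∪p₂ : ∀ z → T (p₁ z) ⊎ T (p₂ z))
         (p₁∩p₂ : ∀ z → T (p₁ z) → T (p₂ z) → ∃[ v ] map s v ≡ z)
         (edge-inside : ∀ {a b} → E G a b → (T (p₁ a) × T (p₁ b)) ⊎ (T (p₂ a) × T (p₂ b))) where

  sub-pushout : IsPushout (corestrict s s∈p₁) (corestrict s s∈p₂) (sub-inclusion G p₁) (sub-inclusion G p₂)
  sub-pushout = record { commute = λ _ → refl ; cover = cover ; glue = glue ; edges = edges }
    where
    cover : ∀ z → (∃[ x ] proj₁ x ≡ z) ⊎ (∃[ w ] proj₁ w ≡ z)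
    cover z with p₁∪p₂ z
    ... | inj₁ z∈p₁ = inj₁ ((z , z∈p₁) , refl)
    ... | inj₂ z∈p₂ = inj₂ ((z , z∈p₂) , refl)
    glue : ∀ (x : Σ (V G) (T ∘ p₁)) (w : Σ (V G) (T ∘ p₂)) → proj₁ x ≡ proj₁ w →
           ∃[ v ] ((map s v , s∈p₁ v) ≡ x × (map s v , s∈p₂ v) ≡ w)
    glue (z , z∈p₁) (.z , z∈p₂) refl =
      let (v , sv≡z) = p₁∩p₂ z z∈p₁ z∈p₂ in v , proj₁-injective sv≡z , proj₁-injective sv≡z
    edges : ∀ a b → E G a b →
            (∃[ x ] ∃[ y ] (proj₁ x ≡ a × proj₁ y ≡ b × E G (proj₁ x) (proj₁ y)))
            ⊎ (∃[ x ] ∃[ y ] (proj₁ x ≡ a × proj₁ y ≡ b × E G (proj₁ x) (proj₁ y)))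
    edges a b eab with edge-inside eab
    ... | inj₁ (a∈p₁ , b∈p₁) = inj₁ ((a , a∈p₁) , (b , b∈p₁) , refl , refl , eab)
    ... | inj₂ (a∈p₂ , b∈p₂) = inj₂ ((a , a∈p₂) , (b , b∈p₂) , refl , refl , eab)

-- With Θ₁ = Θ[s ∪ q] and Θ₂ = Θ[s ∪ ¬q], T₀ is the free sum of (Δ, Θ₁) and (s, Θ₂); the
-- witnesses w₂ ∉ Θ₁ and w₁ ∉ Θ₂ make both big graphs proper, hence not isomorphic to Θ.
module SplitAlongSeparator {m n l : ℕ} (T₀ : GraphType) (ord : HasOrder T₀ m n)
             (s : Fin l → V (Θ T₀)) (s-injective : Injective _≡_ _≡_ s) (l≤m : l ≤ m)
             (q : V (Θ T₀) → Bool)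
             (q-constant : ∀ {a b} → NotIn s a → NotIn s b → E (Θ T₀) a b → q a ≡ q b)
             (ι-in-q : ∀ u → NotIn s (map (ι T₀) u) → T (q (map (ι T₀) u)))
             (w₁ : V (Θ T₀)) (w₁∉s : NotIn s w₁) (w₁∈q : T (q w₁))
             (w₂ : V (Θ T₀)) (w₂∉s : NotIn s w₂) (w₂∉q : ¬ T (q w₂)) where
  private
    Θ₀ = Θ T₀
    Θ-finite = proj₂ ord

  s∋? : ∀ z → Dec (∃[ i ] s i ≡ z)
  s∋? z = any? λ i → finite-≟ (proj₁ Θ-finite) (s i) z

  in-s : V Θ₀ → Bool
  in-s z = isYes (s∋? z)

  NotIn⇒¬in-s : ∀ {z} → NotIn s z → ¬ T (in-s z)
  NotIn⇒¬in-s {z} z∉s t = let (i , si≡z) = toWitness {a? = s∋? z} t in z∉s i si≡z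

  ¬in-s⇒NotIn : ∀ {z} → ¬ T (in-s z) → NotIn s z
  ¬in-s⇒NotIn {z} ¬t i si≡z = ¬t (fromWitness {a? = s∋? z} (i , si≡z))

  side₁ side₂ : V Θ₀ → Bool
  side₁ z = in-s z ∨ q z
  side₂ z = in-s z ∨ not (q z)

  s∈side₁ : ∀ i → T (side₁ (s i))
  s∈side₁ i = T-∨-intro (in-s (s i)) _ λ s∉s → contradiction refl (¬in-s⇒NotIn s∉s i)

  s∈side₂ : ∀ i → T (side₂ (s i))
  s∈side₂ i = T-∨-intro (in-s (s i)) _ λ s∉s → contradiction refl (¬in-s⇒NotIn s∉s i)

  ι∈side₁ : ∀ u → T (side₁ (map (ι T₀) u))
  ι∈side₁ u = T-∨-intro (in-s _) _ (ι-in-q u ∘ ¬in-s⇒NotIn)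

  w₂∉side₁ : ¬ T (side₁ w₂)
  w₂∉side₁ t = w₂∉q (T-∨-elim (in-s w₂) _ t (NotIn⇒¬in-s w₂∉s))

  w₁∉side₂ : ¬ T (side₂ w₁)
  w₁∉side₂ t = T-not⇒¬T (q w₁) (T-∨-elim (in-s w₁) (not (q w₁)) t (NotIn⇒¬in-s w₁∉s)) w₁∈q

  edge-inside : ∀ {a b} → E Θ₀ a b → (T (side₁ a) × T (side₁ b)) ⊎ (T (side₂ a) × T (side₂ b))
  edge-inside {a} {b} eab = T-∨-same-side (in-s a) (q a) (in-s b) (q b)
    λ a∉s b∉s → q-constant (¬in-s⇒NotIn a∉s) (¬in-s⇒NotIn b∉s) eab

  side₁∩side₂ : ∀ z → T (side₁ z) → T (side₂ z) → ∃[ i ] s i ≡ z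
  side₁∩side₂ z t₁ t₂ = toWitness {a? = s∋? z} (T-∨-and-∨-not (in-s z) (q z) t₁ t₂)

  S↪Θ : Embedding (Induced Θ₀ s) Θ₀
  S↪Θ = induced-embedding Θ₀ s s-injective

  T₁ T₂ : GraphType
  T₁ = gtype (Δ T₀) (Sub Θ₀ side₁) (corestrict (ι T₀) ι∈side₁)
  T₂ = gtype (Induced Θ₀ s) (Sub Θ₀ side₂) (corestrict S↪Θ s∈side₂)

  free-sum : IsoToFreeSum T₀ T₁ T₂ (corestrict S↪Θ s∈side₁)
  free-sum =
    Θ₀ , sub-inclusion Θ₀ side₁ , sub-inclusion Θ₀ side₂ ,
    sub-pushout Θ₀ side₁ side₂ S↪Θ s∈side₁ s∈side₂
                (λ z → T-∨-or-∨-not (in-s z) (q z)) side₁∩side₂ edge-inside ,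
    graphIso-refl {Δ T₀} , graphIso-refl {Θ₀} , λ _ → refl

  not-irreducible : ¬ Irreducible m n T₀
  not-irreducible irreducible
    with (k₁ , _ , Θ₁-finite) ← sub-finite {Θ₀} Θ-finite side₁
       | (k₂ , k₂≤n , Θ₂-finite) ← sub-finite {Θ₀} Θ-finite side₂
    with irreducible T₁ T₂ _ (m , k₁ , proj₁ ord , Θ₁-finite)
                     l k₂ ((↔-refl , λ i j → proj₂ Θ-finite (s i) (s j)) , Θ₂-finite) l≤m k₂≤n free-sum
  ... | inj₁ (_ , Θ≅Θ₁ , _) = sub-not-iso (proj₁ Θ-finite) side₁ w₂ w₂∉side₁ Θ≅Θ₁
  ... | inj₂ (_ , Θ≅Θ₂ , _) = sub-not-iso (proj₁ Θ-finite) side₂ w₁ w₁∉side₂ Θ≅Θ₂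

connected⇒irreducible : ∀ {m n} (T₀ : GraphType) → HasOrder T₀ m n →
                        IsConnected (Cl T₀) (m + 1) → Irreducible m n T₀
connected⇒irreducible T₀ ((Δ-finite , _) , _) connected T₁ T₂ e (_ , _ , _ , (Θ₁-finite , _))
                      k _ ((Δ₂-finite , _) , (Θ₂-finite , _)) k≤m _ (_ , _ , _ , pushout , T₀≅Sum)
  with onto-or-missed Δ₂-finite Θ₂-finite (map (ι T₂)) | onto-or-missed Δ₂-finite Θ₁-finite (map e)
... | inj₁ ι₂-onto | _ = inj₁ (FreeSum.typeIso-summand₁ T₁ T₂ pushout {T₀} T₀≅Sum ι₂-onto)
... | inj₂ _ | inj₁ e-onto =
  inj₂ (FreeSum.typeIso-summand₂ T₁ T₂ pushout {T₀} Δ-finite Δ₂-finite k≤m T₀≅Sum e-onto)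
... | inj₂ (w , w∉ι₂) | inj₂ (x , x∉e) =
  ⊥-elim (isConnected-transport (Cl-iso T₀≅Sum) connected k (≤⇒<+1 k≤m)
            (FreeSum.separator-decomposable T₁ T₂ pushout Δ₂-finite x w x∉e w∉ι₂))

irreducible⇒connected : ∀ {m n} (T₀ : GraphType) → HasOrder T₀ m n →
                        Irreducible m n T₀ → IsConnected (Cl T₀) (m + 1)
irreducible⇒connected {m} T₀ ord irreducible l l<m+1 (s , s-injective , x , y , x∉s , y∉s , x↛y) =
  finite-¬¬-decidable (proj₁ (proj₂ ord)) R λ R? →
  ¬¬-excluded-middle {A = ∃[ u ] NotIn s (map (ι T₀) u) × ¬ R (map (ι T₀) u)} λ where
    (yes (u₀ , ιu₀∉s , ιu₀↛)) → some-ι-unreached R? u₀ ιu₀∉s ιu₀↛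
    (no ¬unreached) → all-ι-reached R? λ u ιu∉s →
      decidable-stable (R? (map (ι T₀) u)) (¬unreached ∘ (u ,_) ∘ (ιu∉s ,_))
  where
  R : V (Θ T₀) → Set
  R = Reach (Cl T₀) (NotIn s) x

  R-constant : ∀ {a b} → NotIn s a → NotIn s b → E (Θ T₀) a b → R a ⇔ R b
  R-constant a∉s b∉s eab =
    mk⇔ (λ r → Reach-snoc r b∉s (inj₁ eab)) (λ r → Reach-snoc r a∉s (inj₁ (E-sym (Θ T₀) eab)))

  l≤m : l ≤ m
  l≤m = <+1⇒≤ l<m+1

  all-ι-reached : Decidable R → (∀ u → NotIn s (map (ι T₀) u) → R (map (ι T₀) u)) → ⊥
  all-ι-reached R? ι-reached =
    SplitAlongSeparator.not-irreducible T₀ ord s s-injective l≤m (isYes ∘ R?)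
      (λ a∉s b∉s eab → isYes-⇔ (R-constant a∉s b∉s eab) (R? _) (R? _))
      (λ u ιu∉s → fromWitness {a? = R? _} (ι-reached u ιu∉s))
      x x∉s (fromWitness {a? = R? x} (here x∉s))
      y y∉s (x↛y ∘ toWitness {a? = R? y})
      irreducible

  some-ι-unreached : Decidable R → ∀ u₀ → NotIn s (map (ι T₀) u₀) → ¬ R (map (ι T₀) u₀) → ⊥
  some-ι-unreached R? u₀ ιu₀∉s ιu₀↛ =
    SplitAlongSeparator.not-irreducible T₀ ord s s-injective l≤m (isNo ∘ R?)
      (λ a∉s b∉s eab → cong not (isYes-⇔ (R-constant a∉s b∉s eab) (R? _) (R? _)))
      (λ u _ → fromWitnessFalse {a? = R? _} (ι-unreached u))
      (map (ι T₀) u₀) ιu₀∉s (fromWitnessFalse {a? = R? _} ιu₀↛)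
      x x∉s (λ t → toWitnessFalse {a? = R? x} t (here x∉s))
      irreducible
    where
    -- ι(Δ) is a clique in Cl T₀, so reaching any ι u would reach ι u₀.
    ι-unreached : ∀ u → ¬ R (map (ι T₀) u)
    ι-unreached u r with finite-≟ (proj₁ (proj₂ ord)) (map (ι T₀) u) (map (ι T₀) u₀)
    ... | yes ιu≡ιu₀ = ιu₀↛ (subst R ιu≡ιu₀ r)
    ... | no ιu≢ιu₀ = ιu₀↛ (Reach-snoc r ιu₀∉s (inj₂ (ιu≢ιu₀ , u , u₀ , refl , refl)))

mainTheorem8 : (m n : ℕ) → m + 2 ≤ n → (T : GraphType) → HasOrder T m n →
                 Irreducible m n T ⇔ IsConnected (Cl T) (m + 1)
mainTheorem8 m n _ T ord = mk⇔ (irreducible⇒connected T ord) (connected⇒irreducible T ord)
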